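{- Let $G$ be a basic CUH graph in which both $D$ and $\widetilde{D}$ are realized, and let $C\subseteq R$ be a finite clique of red vertices. If the vertices of $C$ have a common blue neighbor, then they have two non-adjacent common blue neighbors.
   Context: All graphs are simple. A 2-colored graph is a graph with a map $\chi\colon V(G)\to\{\text{red},\text{blue}\}$; $R,B$ are the red and blue vertex sets; induced subgraphs inherit colors; isomorphisms are color-preserving. $G$ is ultrahomogeneous if every isomorphism between finite induced subgraphs extends to an automorphism. A CUH graph is a countably infinite ultrahomogeneous 2-colored graph in which $G[R]$ and $G[B]$ are disjoint unions of cliques; $\alpha_R,\alpha_B$ are the independence numbers of $G[R],G[B]$. $G$ is a blow-up if for one color $c$ (other color $c'$) there are a 2-colored graph $H$ whose $c$-colored vertices are independent and $i\in\mathbb{N}_{\ge2}\cup\{\aleph_0\}$ such that $G$ arises from $H$ by replacing each $c$-colored vertex $u$ by a $c$-colored $i$-clique whose vertices are adjacent exactly to the other vertices of the clique and to the $c'$-colored neighbors of $u$ in $H$. A CUH graph is basic if it is not a blow-up and $\min\{\alpha_R,\alpha_B\}\ge2$. A finite 2-colored graph is realized in $G$ if isomorphic to an induced subgraph of $G$. $D$: red $r_1,r_2$, blue $b_1,b_2$, edges $r_1r_2,b_1b_2,r_1b_1,r_1b_2,r_2b_1$. $\widetilde{D}$: red $r_1,r_2$, blue $b_1,b_2$, edges $r_1r_2,b_1b_2,r_2b_2$. -}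

module Defs where

open import Data.Nat using (ℕ; zero; suc; _≤_)
open import Data.Bool using (Bool; true; false; if_then_else_; _≟_)
open import Data.Fin using (Fin; toℕ)
open import Data.Unit using (⊤)
open import Data.Product using (Σ; Σ-syntax; ∃; ∃-syntax; _×_; _,_)
open import Data.Sum using (_⊎_)
open import Relation.Nullary using (¬_; does)
open import Relation.Binary.PropositionalEquality using (_≡_; _≢_; subst)
open import Function.Bundles using (_⇔_)

-- A countably infinite 2-coloured (simple) graph has vertex set ℕ,
--   Boolean adjacency (symmetric, irreflexive) and a colouring.

red blue : Bool
red  = true
blue = false

record CGraph : Set where
  field
    E     : ℕ → ℕ → Bool
    sym   : ∀ x y → E x y ≡ E y x
    irr   : ∀ x → E x x ≡ false
    col   : ℕ → Bool
open CGraph public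

Injective : {A : Set} {n : ℕ} → (Fin n → A) → Set
Injective {n = n} f = ∀ (i j : Fin n) → f i ≡ f j → i ≡ j

-- Ultrahomogeneity: every isomorphism between finite induced subgraphs
-- (given by injective enumerations a, b : Fin n → ℕ, the isomorphism
-- being a i ↦ b i) extends to an automorphism.

record Automorphism (G : CGraph) : Set where
  field
    σ      : ℕ → ℕ
    σ⁻¹    : ℕ → ℕ
    invˡ   : ∀ x → σ⁻¹ (σ x) ≡ x
    invʳ   : ∀ x → σ (σ⁻¹ x) ≡ x
    colPres : ∀ x → col G (σ x) ≡ col G x
    adjPres : ∀ x y → E G (σ x) (σ y) ≡ E G x y

IsFinIso : (G : CGraph) {n : ℕ} → (Fin n → ℕ) → (Fin n → ℕ) → Set
IsFinIso G a b =
  Injective a × Injective b ×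
  (∀ i → col G (a i) ≡ col G (b i)) ×
  (∀ i j → E G (a i) (a j) ≡ E G (b i) (b j))

Ultrahomogeneous : CGraph → Set
Ultrahomogeneous G =
  ∀ (n : ℕ) (a b : Fin n → ℕ) → IsFinIso G a b →
  Σ (Automorphism G) λ φ → ∀ i → Automorphism.σ φ (a i) ≡ b i

-- G[c] is a disjoint union of cliques: there is a labelling of the
-- vertices (by clique names) such that two distinct c-coloured vertices
-- are adjacent iff they lie in the same clique.

UnionOfCliques : CGraph → Bool → Set
UnionOfCliques G c =
  Σ (ℕ → ℕ) λ cl → ∀ x y → col G x ≡ c → col G y ≡ c → x ≢ y →
    (E G x y ≡ true ⇔ cl x ≡ cl y)

IsCUH : CGraph → Set
IsCUH G = Ultrahomogeneous G × UnionOfCliques G red × UnionOfCliques G blue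

IndepSet : (G : CGraph) → Bool → (k : ℕ) → (Fin k → ℕ) → Set
IndepSet G c k f =
  Injective f × (∀ i → col G (f i) ≡ c) × (∀ i j → i ≢ j → E G (f i) (f j) ≡ false)

αAtLeast : CGraph → Bool → ℕ → Set
αAtLeast G c k = Σ (Fin k → ℕ) (IndepSet G c k)

record TwoColGraph : Set₁ where
  field
    V     : Set
    adj   : V → V → Set
    adj-sym : ∀ u v → adj u v → adj v u
    adj-irr : ∀ u → ¬ adj u u
    hcol  : V → Bool
open TwoColGraph public

data Card : Set where
  fin : (n : ℕ) → 2 ≤ n → Card
  ℵ₀  : Card

Idx : Card → Set
Idx (fin n _) = Fin n
Idx ℵ₀        = ℕ

module BlowUp (H : TwoColGraph) (c : Bool) (i : Card) where
  -- a c-coloured vertex receives i copies, the others a single copy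
  Slot : Bool → Set
  Slot b = if does (b ≟ c) then Idx i else ⊤

  BV : Set
  BV = Σ (V H) λ u → Slot (hcol H u)

  bcol : BV → Bool
  bcol (u , _) = hcol H u

  badj : BV → BV → Set
  badj (u , k) (v , l) =
    (u ≢ v × adj H u v) ⊎
    (Σ (u ≡ v) λ e → hcol H u ≡ c × subst (λ w → Slot (hcol H w)) e k ≢ l)

IsoToBlowUp : CGraph → TwoColGraph → Bool → Card → Set
IsoToBlowUp G H c i =
  Σ (ℕ → BV) λ φ → Σ (BV → ℕ) λ ψ →
    (∀ x → ψ (φ x) ≡ x) × (∀ p → φ (ψ p) ≡ p) ×
    (∀ x → bcol (φ x) ≡ col G x) ×
    (∀ x y → (E G x y ≡ true ⇔ badj (φ x) (φ y)))
  where open BlowUp H c i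

IsBlowUp : CGraph → Set₁
IsBlowUp G =
  Σ Bool λ c → Σ TwoColGraph λ H →
    (∀ u v → hcol H u ≡ c → hcol H v ≡ c → ¬ adj H u v) ×
    Σ Card λ i → IsoToBlowUp G H c i

IsBasic : CGraph → Set₁
IsBasic G = IsCUH G × ¬ IsBlowUp G × αAtLeast G red 2 × αAtLeast G blue 2

Realized : (G : CGraph) (n : ℕ) → (Fin n → Bool) → (Fin n → Fin n → Bool) → Set
Realized G n fc fa =
  Σ (Fin n → ℕ) λ f → Injective f ×
    (∀ i → col G (f i) ≡ fc i) × (∀ i j → E G (f i) (f j) ≡ fa i j)

-- vertices 0,1,2,3 = r₁, r₂, b₁, b₂
colD : Fin 4 → Bool
colD i = isRed (toℕ i)
  where
  isRed : ℕ → Bool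
  isRed 0 = true
  isRed 1 = true
  isRed _ = false

-- D : edges r₁r₂, b₁b₂, r₁b₁, r₁b₂, r₂b₁
adjDℕ : ℕ → ℕ → Bool
adjDℕ 0 1 = true
adjDℕ 1 0 = true
adjDℕ 2 3 = true
adjDℕ 3 2 = true
adjDℕ 0 2 = true
adjDℕ 2 0 = true
adjDℕ 0 3 = true
adjDℕ 3 0 = true
adjDℕ 1 2 = true
adjDℕ 2 1 = true
adjDℕ _ _ = false

adjD : Fin 4 → Fin 4 → Bool
adjD i j = adjDℕ (toℕ i) (toℕ j)

-- D̃ : edges r₁r₂, b₁b₂, r₂b₂
adjD̃ℕ : ℕ → ℕ → Bool
adjD̃ℕ 0 1 = true
adjD̃ℕ 1 0 = true
adjD̃ℕ 2 3 = true
adjD̃ℕ 3 2 = true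
adjD̃ℕ 1 3 = true
adjD̃ℕ 3 1 = true
adjD̃ℕ _ _ = false

adjD̃ : Fin 4 → Fin 4 → Bool
adjD̃ i j = adjD̃ℕ (toℕ i) (toℕ j)

RedClique : (G : CGraph) (k : ℕ) → (Fin k → ℕ) → Set
RedClique G k C =
  Injective C × (∀ i → col G (C i) ≡ red) × (∀ i j → i ≢ j → E G (C i) (C j) ≡ true)

CommonBlueNbr : (G : CGraph) (k : ℕ) → (Fin k → ℕ) → ℕ → Set
CommonBlueNbr G k C b = col G b ≡ blue × (∀ i → E G (C i) b ≡ true)

-- Fix a blue vertex w outside the blue clique of the given common neighbour b
-- (possible since α_B ≥ 2).  By induction on |C| one finds a common blue
-- neighbour of C in the blue clique of w; it is then not adjacent to b.
-- For the induction step, let y₀ be a common neighbour of C∖{c} in that clique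
-- with c ≁ y₀ (if C = {c}, a copy of D on c, y₀ yields the vertex directly).
-- Otherwise ultrahomogeneity applied to b ↦ y₀ (fixing C∖{c}) moves c to a red
-- z in the clique of C adjacent to y₀ and to C∖{c}; the copy of D on z, c, y₀ gives a
-- blue u adjacent to all three, hence in the clique of y₀; and the automorphism
-- fixing u and C∖{c} and sending z to c moves y₀ to the required vertex.
module Submission where

open import Defs
open import Data.Nat using (ℕ)
open import Data.Fin using (Fin)
open import Data.Bool using (false)
open import Data.Product using (Σ; _×_)
open import Relation.Binary.PropositionalEquality using (_≡_; _≢_)

open import Data.Nat using (zero; suc) renaming (_≟_ to _≟ℕ_)
open import Data.Fin using (zero; suc)
open import Data.Fin.Properties using (suc-injective; 0≢1+n)
open import Data.Bool using (Bool; true)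
open import Data.Empty using (⊥-elim)
open import Data.Product using (_,_; proj₁; proj₂)
open import Data.Vec.Functional using ([]; _∷_; tail)
open import Function.Bundles using (Equivalence)
open import Relation.Nullary using (yes; no)
open import Relation.Binary.PropositionalEquality using (refl; cong; ≢-sym)
import Relation.Binary.PropositionalEquality as ≡

module Adjacency (G : CGraph) where

  infix 4 _~_ _≁_

  _~_ _≁_ : ℕ → ℕ → Set
  x ~ y = E G x y ≡ true
  x ≁ y = E G x y ≡ false

  ~-sym : ∀ {x y} → x ~ y → y ~ x
  ~-sym {x} {y} x~y = ≡.trans (sym G y x) x~y

  ≁-sym : ∀ {x y} → x ≁ y → y ≁ x
  ≁-sym {x} {y} x≁y = ≡.trans (sym G y x) x≁y

  ~⇒≢ : ∀ {x y} → x ~ y → x ≢ y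
  ~⇒≢ {x} x~x refl with ≡.trans (≡.sym x~x) (irr G x)
  ... | ()

  red≢blue : ∀ {x y} → col G x ≡ red → col G y ≡ blue → x ≢ y
  red≢blue {x} x-red y-blue refl with ≡.trans (≡.sym x-red) y-blue
  ... | ()

  blue≢red : ∀ {x y} → col G x ≡ blue → col G y ≡ red → x ≢ y
  blue≢red x-blue y-red = ≢-sym (red≢blue y-red x-blue)

  ~≁⇒≢ : ∀ {x y v} → x ~ v → y ≁ v → x ≢ y
  ~≁⇒≢ x~v y≁v refl with ≡.trans (≡.sym x~v) y≁v
  ... | ()

  tail-injective : ∀ {k} {C : Fin (suc k) → ℕ} → Injective C → Injective (tail C)
  tail-injective C-inj i j e = suc-injective (C-inj _ _ e)

  RedClique-tail : ∀ {k} {C : Fin (suc k) → ℕ} → RedClique G (suc k) C → RedClique G k (tail C)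
  RedClique-tail (C-inj , C-red , C-adj) =
    tail-injective C-inj , (λ i → C-red (suc i)) , λ i j i≢j → C-adj _ _ (λ e → i≢j (suc-injective e))

module Cliques (G : CGraph) {c : Bool} (U : UnionOfCliques G c) where

  open Adjacency G

  clique : ℕ → ℕ
  clique = proj₁ U

  ~⇒same-clique : ∀ {x y} → col G x ≡ c → col G y ≡ c → x ~ y → clique x ≡ clique y
  ~⇒same-clique x-c y-c x~y = Equivalence.to (proj₂ U _ _ x-c y-c (~⇒≢ x~y)) x~y

  same-clique⇒~ : ∀ {x y} → col G x ≡ c → col G y ≡ c → x ≢ y → clique x ≡ clique y → x ~ y
  same-clique⇒~ x-c y-c x≢y = Equivalence.from (proj₂ U _ _ x-c y-c x≢y)

  different-cliques⇒≁ : ∀ {x y} → col G x ≡ c → col G y ≡ c → clique x ≢ clique y → x ≁ y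
  different-cliques⇒≁ {x} {y} x-c y-c ne with E G x y in x~y
  ... | true  = ⊥-elim (ne (~⇒same-clique x-c y-c x~y))
  ... | false = refl

  ~-via : ∀ {x y v} → col G x ≡ c → col G y ≡ c → col G v ≡ c →
          x ~ v → y ~ v → x ≢ y → x ~ y
  ~-via x-c y-c v-c x~v y~v x≢y = same-clique⇒~ x-c y-c x≢y
    (≡.trans (~⇒same-clique x-c v-c x~v) (≡.sym (~⇒same-clique y-c v-c y~v)))

  ≁⇒different-cliques : ∀ {x y} → col G x ≡ c → col G y ≡ c → x ≢ y → x ≁ y → clique x ≢ clique y
  ≁⇒different-cliques x-c y-c x≢y x≁y same with ≡.trans (≡.sym (same-clique⇒~ x-c y-c x≢y same)) x≁y
  ... | ()

  another-clique : αAtLeast G c 2 → ∀ x → Σ ℕ λ w → col G w ≡ c × clique w ≢ clique x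
  another-clique (g , g-inj , g-c , g-indep) x with clique (g zero) ≟ℕ clique x
  ... | no  g₀∉x = g zero , g-c zero , g₀∉x
  ... | yes g₀∈x = g (suc zero) , g-c (suc zero) , λ g₁∈x →
        ≁⇒different-cliques (g-c zero) (g-c (suc zero)) (λ e → 0≢1+n (g-inj _ _ e))
          (g-indep zero (suc zero) (λ ())) (≡.trans g₀∈x (≡.sym g₁∈x))

module FiniteIsomorphisms (G : CGraph) where

  []-iso : IsFinIso G [] []
  []-iso = (λ ()) , (λ ()) , (λ ()) , (λ ())

  id-iso : ∀ {n} {a : Fin n → ℕ} → Injective a → IsFinIso G a a
  id-iso a-inj = a-inj , a-inj , (λ _ → refl) , (λ _ _ → refl)

  ∷-injective : ∀ {n x} {a : Fin n → ℕ} → Injective a → (∀ i → a i ≢ x) → Injective (x ∷ a)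
  ∷-injective a-inj x∉a zero    zero    _ = refl
  ∷-injective a-inj x∉a zero    (suc j) e = ⊥-elim (x∉a j (≡.sym e))
  ∷-injective a-inj x∉a (suc i) zero    e = ⊥-elim (x∉a i e)
  ∷-injective a-inj x∉a (suc i) (suc j) e = cong suc (a-inj i j e)

  ∷-iso : ∀ {n x y} {a b : Fin n → ℕ} → IsFinIso G a b →
          col G x ≡ col G y → (∀ i → E G (a i) x ≡ E G (b i) y) →
          (∀ i → a i ≢ x) → (∀ i → b i ≢ y) → IsFinIso G (x ∷ a) (y ∷ b)
  ∷-iso {x = x} {y} {a} {b} (a-inj , b-inj , cols , adjs) xy-col xy-adj x∉a y∉b =
    ∷-injective a-inj x∉a , ∷-injective b-inj y∉b , cols′ , adjs′
    where
    cols′ : ∀ i → col G ((x ∷ a) i) ≡ col G ((y ∷ b) i)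
    cols′ zero    = xy-col
    cols′ (suc i) = cols i
    adjs′ : ∀ i j → E G ((x ∷ a) i) ((x ∷ a) j) ≡ E G ((y ∷ b) i) ((y ∷ b) j)
    adjs′ zero    zero    = ≡.trans (irr G x) (≡.sym (irr G y))
    adjs′ zero    (suc j) = ≡.trans (sym G x (a j)) (≡.trans (xy-adj j) (sym G (b j) y))
    adjs′ (suc i) zero    = xy-adj i
    adjs′ (suc i) (suc j) = adjs i j

  one-point-extension : Ultrahomogeneous G → ∀ {n} {a b : Fin n → ℕ} → IsFinIso G a b →
    ∀ x → Σ ℕ λ y → col G y ≡ col G x × (∀ i → E G (b i) y ≡ E G (a i) x)
  one-point-extension UH {a = a} iso x with UH _ _ _ iso
  ... | φ , σa≡b = σ x , colPres x , λ i →
        ≡.trans (cong (λ v → E G v (σ x)) (≡.sym (σa≡b i))) (adjPres (a i) x)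
    where open Automorphism φ

module CommonNeighbours (G : CGraph) (UH : Ultrahomogeneous G)
  (U-red : UnionOfCliques G red) (U-blue : UnionOfCliques G blue)
  (D : Realized G 4 colD adjD) where

  open Adjacency G
  open FiniteIsomorphisms G
  module Red  = Cliques G U-red
  module Blue = Cliques G U-blue

  CommonBlueNbrIn : (k : ℕ) → (Fin k → ℕ) → ℕ → Set
  CommonBlueNbrIn k C w = Σ ℕ λ y → CommonBlueNbr G k C y × Blue.clique y ≡ Blue.clique w

  private
    f : Fin 4 → ℕ
    f = proj₁ D
    f-inj : Injective f
    f-inj = proj₁ (proj₂ D)
    f-col : ∀ i → col G (f i) ≡ colD i
    f-col = proj₁ (proj₂ (proj₂ D))
    f-adj : ∀ i j → E G (f i) (f j) ≡ adjD i j
    f-adj = proj₂ (proj₂ (proj₂ D))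

    r₁ r₂ b₁ b₂ : ℕ
    r₁ = f zero
    r₂ = f (suc zero)
    b₁ = f (suc (suc zero))
    b₂ = f (suc (suc (suc zero)))

  D-iso₂ : ∀ {c y} → col G c ≡ red → col G y ≡ blue → c ≁ y →
           IsFinIso G (r₂ ∷ b₂ ∷ []) (c ∷ y ∷ [])
  D-iso₂ c-red y-blue c≁y =
    ∷-iso (∷-iso []-iso (≡.trans (f-col _) (≡.sym y-blue)) (λ ()) (λ ()) (λ ()))
          (≡.trans (f-col _) (≡.sym c-red))
          (λ { zero → ≡.trans (f-adj _ _) (≡.sym (≁-sym c≁y)) })
          (λ { zero → blue≢red (f-col _) (f-col _) })
          (λ { zero → blue≢red y-blue c-red })

  D-iso₃ : ∀ {z c y} → col G z ≡ red → col G c ≡ red → col G y ≡ blue →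
           z ~ c → z ~ y → c ≁ y → IsFinIso G (r₁ ∷ r₂ ∷ b₂ ∷ []) (z ∷ c ∷ y ∷ [])
  D-iso₃ z-red c-red y-blue z~c z~y c≁y =
    ∷-iso (D-iso₂ c-red y-blue c≁y)
          (≡.trans (f-col _) (≡.sym z-red))
          (λ { zero → ≡.trans (f-adj _ _) (≡.sym (~-sym z~c))
             ; (suc zero) → ≡.trans (f-adj _ _) (≡.sym (~-sym z~y)) })
          (λ { zero e → 0≢1+n (f-inj _ _ (≡.sym e))
             ; (suc zero) → blue≢red (f-col _) (f-col _) })
          (λ { zero → ≢-sym (~⇒≢ z~c)
             ; (suc zero) → blue≢red y-blue z-red })

  D-common-neighbour₂ : ∀ {c y} → col G c ≡ red → col G y ≡ blue → c ≁ y →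
    Σ ℕ λ u → col G u ≡ blue × c ~ u × y ~ u
  D-common-neighbour₂ c-red y-blue c≁y
    with one-point-extension UH (D-iso₂ c-red y-blue c≁y) b₁
  ... | u , u-col , u-adj =
    u , ≡.trans u-col (f-col _) ,
    ≡.trans (u-adj zero) (f-adj _ _) , ≡.trans (u-adj (suc zero)) (f-adj _ _)

  D-common-neighbour₃ : ∀ {z c y} → col G z ≡ red → col G c ≡ red → col G y ≡ blue →
    z ~ c → z ~ y → c ≁ y → Σ ℕ λ u → col G u ≡ blue × z ~ u × c ~ u × y ~ u
  D-common-neighbour₃ z-red c-red y-blue z~c z~y c≁y
    with one-point-extension UH (D-iso₃ z-red c-red y-blue z~c z~y c≁y) b₁
  ... | u , u-col , u-adj =
    u , ≡.trans u-col (f-col _) , ≡.trans (u-adj zero) (f-adj _ _) ,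
    ≡.trans (u-adj (suc zero)) (f-adj _ _) , ≡.trans (u-adj (suc (suc zero))) (f-adj _ _)

  common-neighbour-iso : ∀ {k} {C : Fin (suc k) → ℕ} → RedClique G (suc k) C → ∀ {b y₀} →
    CommonBlueNbr G (suc k) C b → CommonBlueNbr G k (tail C) y₀ → IsFinIso G (b ∷ tail C) (y₀ ∷ tail C)
  common-neighbour-iso (C-inj , C-red , _) (b-blue , C~b) (y₀-blue , T~y₀) =
    ∷-iso (id-iso (tail-injective C-inj)) (≡.trans b-blue (≡.sym y₀-blue))
          (λ i → ≡.trans (C~b (suc i)) (≡.sym (T~y₀ i)))
          (λ i → red≢blue (C-red (suc i)) b-blue)
          (λ i → red≢blue (C-red (suc i)) y₀-blue)

  head-swap-iso : ∀ {k} {C : Fin (suc k) → ℕ} → RedClique G (suc k) C → ∀ {z u} →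
    col G z ≡ red → (∀ i → z ~ tail C i) → col G u ≡ blue → z ~ u → C zero ~ u →
    IsFinIso G (u ∷ z ∷ tail C) (u ∷ C zero ∷ tail C)
  head-swap-iso (C-inj , C-red , C-adj) z-red z~T u-blue z~u c~u =
    ∷-iso (∷-iso (id-iso (tail-injective C-inj)) (≡.trans z-red (≡.sym (C-red zero)))
                 (λ i → ≡.trans (~-sym (z~T i)) (≡.sym (C-adj (suc i) zero (λ ()))))
                 (λ i → ≢-sym (~⇒≢ (z~T i)))
                 (λ i → ~⇒≢ (C-adj (suc i) zero (λ ()))))
          refl
          (λ { zero → ≡.trans z~u (≡.sym c~u) ; (suc i) → refl })
          (λ { zero → red≢blue z-red u-blue ; (suc i) → red≢blue (C-red (suc i)) u-blue })
          (λ { zero → red≢blue (C-red zero) u-blue ; (suc i) → red≢blue (C-red (suc i)) u-blue })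

  head-copy : ∀ {k} {C : Fin (suc (suc k)) → ℕ} → RedClique G (suc (suc k)) C → ∀ {b y₀} →
    CommonBlueNbr G (suc (suc k)) C b → CommonBlueNbr G (suc k) (tail C) y₀ → C zero ≁ y₀ →
    Σ ℕ λ z → col G z ≡ red × z ~ C zero × z ~ y₀ × (∀ i → z ~ tail C i)
  head-copy {C = C} K@(_ , C-red , C-adj) {y₀ = y₀} b-nbr@(_ , C~b) y₀-nbr c≁y₀
    with one-point-extension UH (common-neighbour-iso K b-nbr y₀-nbr) (C zero)
  ... | z , z-col , z-adj = z , z-red , z~c , z~y₀ , z~T
    where
    z-red : col G z ≡ red
    z-red = ≡.trans z-col (C-red zero)
    z~T : ∀ i → z ~ tail C i
    z~T i = ~-sym (≡.trans (z-adj (suc i)) (C-adj (suc i) zero (λ ())))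
    z~y₀ : z ~ y₀
    z~y₀ = ~-sym (≡.trans (z-adj zero) (~-sym (C~b zero)))
    z~c : z ~ C zero
    z~c = Red.~-via z-red (C-red zero) (C-red (suc zero))
            (z~T zero) (C-adj zero (suc zero) (λ ())) (~≁⇒≢ z~y₀ c≁y₀)

  head-non-adjacent : ∀ {k} {C : Fin (suc k) → ℕ} → RedClique G (suc k) C → ∀ {b y₀} →
    CommonBlueNbr G (suc k) C b → CommonBlueNbr G k (tail C) y₀ → C zero ≁ y₀ →
    CommonBlueNbrIn (suc k) C y₀
  head-non-adjacent {zero} (_ , C-red , _) _ (y₀-blue , _) c≁y₀
    with D-common-neighbour₂ (C-red zero) y₀-blue c≁y₀
  ... | u , u-blue , c~u , y₀~u =
    u , (u-blue , λ { zero → c~u }) , Blue.~⇒same-clique u-blue y₀-blue (~-sym y₀~u)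
  head-non-adjacent {suc k} {C} K@(_ , C-red , _) {y₀ = y₀} b-nbr y₀-nbr@(y₀-blue , T~y₀) c≁y₀
    with head-copy K b-nbr y₀-nbr c≁y₀
  ... | z , z-red , z~c , z~y₀ , z~T
    with D-common-neighbour₃ z-red (C-red zero) y₀-blue z~c z~y₀ c≁y₀
  ... | u , u-blue , z~u , c~u , y₀~u
    with one-point-extension UH (head-swap-iso K z-red z~T u-blue z~u c~u) y₀
  ... | y , y-col , y-adj = y , (y-blue , C~y) , y∈y₀
    where
    y-blue : col G y ≡ blue
    y-blue = ≡.trans y-col y₀-blue
    C~y : ∀ i → C i ~ y
    C~y zero    = ≡.trans (y-adj (suc zero)) z~y₀
    C~y (suc i) = ≡.trans (y-adj (suc (suc i))) (T~y₀ i)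
    u~y : u ~ y
    u~y = ≡.trans (y-adj zero) (~-sym y₀~u)
    y∈y₀ : Blue.clique y ≡ Blue.clique y₀
    y∈y₀ = ≡.trans (Blue.~⇒same-clique y-blue u-blue (~-sym u~y))
                   (Blue.~⇒same-clique u-blue y₀-blue (~-sym y₀~u))

  extend-to-head : ∀ {k} {C : Fin (suc k) → ℕ} → RedClique G (suc k) C → ∀ {b y₀} →
    CommonBlueNbr G (suc k) C b → CommonBlueNbr G k (tail C) y₀ → CommonBlueNbrIn (suc k) C y₀
  extend-to-head {C = C} K {y₀ = y₀} b-nbr y₀-nbr@(y₀-blue , T~y₀) with E G (C zero) y₀ in c-y₀
  ... | true  = y₀ , (y₀-blue , λ { zero → c-y₀ ; (suc i) → T~y₀ i }) , refl
  ... | false = head-non-adjacent K b-nbr y₀-nbr c-y₀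

  common-neighbour-in-clique : ∀ {k} {C : Fin k → ℕ} → RedClique G k C → ∀ {b} →
    CommonBlueNbr G k C b → ∀ {w} → col G w ≡ blue → CommonBlueNbrIn k C w
  common-neighbour-in-clique {zero} _ _ {w} w-blue = w , (w-blue , λ ()) , refl
  common-neighbour-in-clique {suc k} K b-nbr@(b-blue , C~b) w-blue
    with common-neighbour-in-clique (RedClique-tail K) (b-blue , λ i → C~b (suc i)) w-blue
  ... | y₀ , y₀-nbr , y₀∈w with extend-to-head K b-nbr y₀-nbr
  ... | y , y-nbr , y∈y₀ = y , y-nbr , ≡.trans y∈y₀ y₀∈w

  nonadjacent-common-neighbours : αAtLeast G blue 2 → ∀ {k} {C : Fin k → ℕ} → RedClique G k C →
    ∀ {b} → CommonBlueNbr G k C b →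
    Σ ℕ λ y → b ≢ y × b ≁ y × CommonBlueNbr G k C y
  nonadjacent-common-neighbours α-blue K {b} b-nbr@(b-blue , _)
    with Blue.another-clique α-blue b
  ... | w , w-blue , w∉b with common-neighbour-in-clique K b-nbr w-blue
  ... | y , y-nbr@(y-blue , _) , y∈w =
    y , (λ b≡y → b∉y (cong Blue.clique b≡y)) , Blue.different-cliques⇒≁ b-blue y-blue b∉y , y-nbr
    where
    b∉y : Blue.clique b ≢ Blue.clique y
    b∉y b∈y = w∉b (≡.sym (≡.trans b∈y y∈w))

lemma4p3 : (G : CGraph) → IsBasic G →
    Realized G 4 colD adjD → Realized G 4 colD adjD̃ →
    (k : ℕ) (C : Fin k → ℕ) → RedClique G k C →
    Σ ℕ (CommonBlueNbr G k C) →
    Σ ℕ λ b₁ → Σ ℕ λ b₂ → b₁ ≢ b₂ × E G b₁ b₂ ≡ false ×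
    CommonBlueNbr G k C b₁ × CommonBlueNbr G k C b₂
lemma4p3 G ((UH , U-red , U-blue) , _ , _ , α-blue) D _ k C K (b , b-nbr)
  with nonadjacent-common-neighbours α-blue K b-nbr
  where open CommonNeighbours G UH U-red U-blue D
... | y , b≢y , b≁y , y-nbr = b , y , b≢y , b≁y , b-nbr , y-nbr
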